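{- Let $k\ge 3$ be an integer and let $G^3_k(p,q)$ be the graph defined below. Then: (i) $\chi(G^3_k(p,q))=k+1$, and in every proper $(k+1)$-coloring of $G^3_k(p,q)$ the vertices $p$ and $q$ receive distinct colors; (ii) for every $\alpha,\beta\in\{1,\dots,k+1\}$ with $\alpha\ne\beta$, there exists a $(p,\alpha)$-connected greedy coloring of $G^3_k(p,q)$ in which $q$ is colored $\beta$, and a $(q,\beta)$-connected greedy coloring of $G^3_k(p,q)$ in which $p$ is colored $\alpha$.
   Context: The double Mycielskian of a graph $H$ is the graph $H^*$ obtained from $H$ by: adding two copies $V_1,V_2$ of $V(H)$, the copy of $w\in V(H)$ in $V_i$ being denoted $w_i$; for every edge $yz\in E(H)$ and $i\in\{1,2\}$, adding the edges $y_iz$ and $yz_i$; and adding two new adjacent vertices $t_1,t_2$, with $t_i$ adjacent to every vertex of $V_i$ for $i=1,2$. The graph $G^3_k(p,q)$ is obtained by starting from the path $(p,x,y,q)$ on four vertices and applying the double Mycielskian operation $k-1$ times; $p$ and $q$ denote the original endpoints of this path. A connected ordering is an ordering $(v_1,\dots,v_n)$ of the vertices in which each $v_i$, $i\ge 2$, has a neighbour among $v_1,\dots,v_{i-1}$. Given a vertex $s$ and positive integer $\alpha$, an $(s,\alpha)$-connected greedy coloring is a coloring obtained from some connected ordering starting with $s$ by coloring $s$ with $\alpha$ and then coloring each subsequent vertex with the smallest positive integer not used on its already-coloured neighbours. -}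

module Defs where

open import Data.Nat using (ℕ; zero; suc; _+_; _≤_; _<_)
open import Data.Fin using (Fin; toℕ)
open import Data.Empty using (⊥)
open import Data.Unit using (⊤)
open import Data.Sum using (_⊎_)
open import Data.Product using (Σ; _×_; ∃; ∃-syntax)
open import Data.List using (List; []; _∷_; _++_)
open import Data.List.Membership.Propositional using (_∈_)
open import Data.List.Relation.Unary.Unique.Propositional using (Unique)
open import Relation.Binary.PropositionalEquality using (_≡_)
open import Relation.Nullary using (¬_)

-- Vertices of the graph obtained from the path (p,x,y,q) by m applications
-- of the double Mycielskian.
data V : ℕ → Set where
  pv   : Fin 4 → V zero          -- path vertices: 0 = p, 1 = x, 2 = y, 3 = q
  orig : ∀ {m} → V m → V (suc m)
  cp1  : ∀ {m} → V m → V (suc m)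
  cp2  : ∀ {m} → V m → V (suc m)
  t1   : ∀ {m} → V (suc m)
  t2   : ∀ {m} → V (suc m)

Adj : ∀ {m} → V m → V m → Set
Adj (pv i)   (pv j)   = (suc (toℕ i) ≡ toℕ j) ⊎ (suc (toℕ j) ≡ toℕ i)
Adj (orig a) (orig b) = Adj a b
Adj (orig a) (cp1 b)  = Adj a b
Adj (cp1 a)  (orig b) = Adj a b
Adj (orig a) (cp2 b)  = Adj a b
Adj (cp2 a)  (orig b) = Adj a b
Adj t1       (cp1 _)  = ⊤
Adj (cp1 _)  t1       = ⊤
Adj t2       (cp2 _)  = ⊤
Adj (cp2 _)  t2       = ⊤
Adj t1       t2       = ⊤
Adj t2       t1       = ⊤
Adj _        _        = ⊥

pV : (m : ℕ) → V m
pV zero    = pv (Data.Fin.zero)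
pV (suc m) = orig (pV m)

qV : (m : ℕ) → V m
qV zero    = pv (Data.Fin.suc (Data.Fin.suc (Data.Fin.suc Data.Fin.zero)))
qV (suc m) = orig (qV m)

-- G^3_k(p,q): k-1 applications of the double Mycielskian; vertex type for k.
Gk : ℕ → Set
Gk k = V (Data.Nat._∸_ k 1)

pG : (k : ℕ) → Gk k
pG k = pV (Data.Nat._∸_ k 1)

qG : (k : ℕ) → Gk k
qG k = qV (Data.Nat._∸_ k 1)

Proper : ∀ {m n} → (V m → Fin n) → Set
Proper {m} c = ∀ (u v : V m) → Adj u v → ¬ (c u ≡ c v)

Colorable : ℕ → ℕ → Set
Colorable m n = Σ (V m → Fin n) Proper

ChromaticNumber : ℕ → ℕ → Set
ChromaticNumber m n = Colorable m n × (∀ j → Colorable m j → n ≤ j)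

SmallestFree : ∀ {m} → (V m → ℕ) → List (V m) → V m → Set
SmallestFree {m} c earlier v =
  (1 ≤ c v)
  × ¬ (∃[ u ] (u ∈ earlier × Adj u v × c u ≡ c v))
  × (∀ j → 1 ≤ j → j < c v → ∃[ u ] (u ∈ earlier × Adj u v × c u ≡ j))

ConnectedGreedy : ∀ {m} → V m → ℕ → (V m → ℕ) → Set
ConnectedGreedy {m} s α c =
  Σ (List (V m)) λ rest →
    Unique (s ∷ rest)
    × (∀ v → v ∈ (s ∷ rest))
    × (c s ≡ α)
    × (∀ pre v suf → rest ≡ pre ++ (v ∷ suf) →
         (∃[ u ] (u ∈ (s ∷ pre) × Adj u v))
         × SmallestFree c (s ∷ pre) v)

module Submission where

-- After
-- basic facts on G_m (adjacency, an enumeration of the vertices) and on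
-- greedy steps (only earlier neighbours matter, independent sets may be
-- coloured in any order, steps coloured by mex), two constructions lift a run
-- from G_m to G_{m+1}: extend-run keeps both end colours, shift-run inserts a
-- new colour γ ∈ {1, 2} below the old ones.  Starting from the greedy runs
-- along the path they realise every admissible pair of end colours by
-- induction on m; runs from q follow by the reflection automorphism
-- exchanging p and q.  Part (i) is the Mycielski argument for Fin-valued
-- colourings: an explicit (m+2)-colouring, and a reduction from a proper
-- colouring of G_{m+1} to one of G_m with one colour fewer (recolour the
-- originals coloured like an apex tᵢ by their copies in Vᵢ, then drop that
-- colour), which keeps p and q equally coloured for a well chosen side i.

open import Defs
open import Data.Nat using (ℕ; zero; suc; _+_; _≤_; _<_; z≤n; s≤s; s≤s⁻¹; _≤?_)
open import Data.Nat.Properties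
  using ( ≤-refl; ≤-trans; ≤-reflexive; n≤1+n; 1+n≰n; <⇒≢; <⇒≱; <⇒≤; ≤∧≢⇒<; ≤-antisym; <-cmp
        ; +-suc; +-comm; +-cancelʳ-≡; suc-injective)
open import Data.Fin using (Fin; toℕ; inject₁; fromℕ; punchOut; opposite)
  renaming (zero to fz; suc to fs)
open import Data.Fin.Properties
  using (inject₁-injective; fromℕ≢inject₁; punchOut-injective; punchOut-cong; opposite-involutive)
  renaming (_≟_ to _≟ᶠ_)
open import Data.Empty using (⊥; ⊥-elim)
open import Data.Unit using (⊤; tt)
open import Data.Sum using (_⊎_; inj₁; inj₂; [_,_])
open import Data.Product using (_×_; _,_; proj₁; proj₂; ∃-syntax)
open import Data.List using (List; []; _∷_; _++_; map; filter; allFin)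
open import Data.List.Properties
  using (++-assoc; ++-identityʳ; map-++; map-∘; map-id; map-cong; partition-defn)
open import Data.List.Membership.Propositional using (_∈_; _∉_)
open import Data.List.Membership.Propositional.Properties
  using (∈-map⁺; ∈-map⁻; ∈-++⁺ˡ; ∈-++⁺ʳ; ∈-++⁻; ∈-allFin; ∈-filter⁺; ∈-filter⁻)
open import Data.List.Relation.Unary.Any using (here; there)
import Data.List.Relation.Unary.Any as Any
open import Data.List.Extrema.Nat using (max; v≤max⁺)
open import Data.List.Membership.DecPropositional Data.Nat._≟_ using () renaming (_∈?_ to _∈ℕ?_)
open import Data.List.Relation.Unary.All using ([]; _∷_)
import Data.List.Relation.Unary.AllPairs as AllPairs
open import Data.List.Relation.Unary.Unique.Propositional using (Unique)
import Data.List.Relation.Unary.Unique.Propositional.Properties as Unique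
open import Data.List.Relation.Binary.Subset.Propositional using (_⊆_)
import Data.List.Relation.Binary.Subset.Propositional.Properties as Subset
open import Data.List.Relation.Binary.Disjoint.Propositional using (Disjoint)
open import Data.List.Relation.Binary.Permutation.Propositional
  using (_↭_; ↭-refl; ↭-sym; ↭-trans; ↭ₛ⇒↭; ↭⇒↭ₛ)
import Data.List.Relation.Binary.Permutation.Setoid.Properties as PermutationSetoid
open import Data.List.Relation.Binary.Permutation.Propositional.Properties
  using (∈-resp-↭; map⁺; shift; ++⁺ˡ; ++-commutativeMonoid) renaming (++⁺ to ++↭)
import Algebra.Solver.CommutativeMonoid as CMSolver
open import Relation.Binary.PropositionalEquality
  using (_≡_; _≢_; refl; sym; trans; cong; subst; setoid; module ≡-Reasoning)
open import Relation.Nullary using (¬_; Dec; yes; no)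
open import Function using (_∘_)
open import Relation.Binary.Definitions using (tri<; tri≈; tri>)
open import Relation.Unary.Properties using (∁?)

Adj-sym : ∀ {m} (u v : V m) → Adj u v → Adj v u
Adj-sym (pv i)   (pv j)   (inj₁ e) = inj₂ e
Adj-sym (pv i)   (pv j)   (inj₂ e) = inj₁ e
Adj-sym (orig a) (orig b) h = Adj-sym a b h
Adj-sym (orig a) (cp1 b)  h = Adj-sym a b h
Adj-sym (cp1 a)  (orig b) h = Adj-sym a b h
Adj-sym (orig a) (cp2 b)  h = Adj-sym a b h
Adj-sym (cp2 a)  (orig b) h = Adj-sym a b h
Adj-sym t1       (cp1 _)  h = tt
Adj-sym (cp1 _)  t1       h = tt
Adj-sym t2       (cp2 _)  h = tt
Adj-sym (cp2 _)  t2       h = tt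
Adj-sym t1       t2       h = tt
Adj-sym t2       t1       h = tt

Adj? : ∀ {m} (u v : V m) → Dec (Adj u v)
Adj? (pv i) (pv j) with suc (toℕ i) Data.Nat.≟ toℕ j | suc (toℕ j) Data.Nat.≟ toℕ i
... | yes e | _     = yes (inj₁ e)
... | no _  | yes e = yes (inj₂ e)
... | no n₁ | no n₂ = no λ { (inj₁ e) → n₁ e ; (inj₂ e) → n₂ e }
Adj? (orig a) (orig b) = Adj? a b
Adj? (orig a) (cp1 b)  = Adj? a b
Adj? (cp1 a)  (orig b) = Adj? a b
Adj? (orig a) (cp2 b)  = Adj? a b
Adj? (cp2 a)  (orig b) = Adj? a b
Adj? t1       (cp1 _)  = yes tt
Adj? (cp1 _)  t1       = yes tt
Adj? t2       (cp2 _)  = yes tt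
Adj? (cp2 _)  t2       = yes tt
Adj? t1       t2       = yes tt
Adj? t2       t1       = yes tt
Adj? (orig _) t1       = no λ ()
Adj? (orig _) t2       = no λ ()
Adj? (cp1 _)  (cp1 _)  = no λ ()
Adj? (cp1 _)  (cp2 _)  = no λ ()
Adj? (cp1 _)  t2       = no λ ()
Adj? (cp2 _)  (cp1 _)  = no λ ()
Adj? (cp2 _)  (cp2 _)  = no λ ()
Adj? (cp2 _)  t1       = no λ ()
Adj? t1       (orig _) = no λ ()
Adj? t1       t1       = no λ ()
Adj? t1       (cp2 _)  = no λ ()
Adj? t2       (orig _) = no λ ()
Adj? t2       t2       = no λ ()
Adj? t2       (cp1 _)  = no λ ()

neighbour : ∀ {m} (v : V m) → ∃[ u ] Adj u v
neighbour (pv fz)                = pv (fs fz) , inj₂ refl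
neighbour (pv (fs fz))           = pv fz , inj₁ refl
neighbour (pv (fs (fs fz)))      = pv (fs fz) , inj₁ refl
neighbour (pv (fs (fs (fs fz)))) = pv (fs (fs fz)) , inj₁ refl
neighbour (orig v) = orig (proj₁ (neighbour v)) , proj₂ (neighbour v)
neighbour (cp1 v)  = orig (proj₁ (neighbour v)) , proj₂ (neighbour v)
neighbour (cp2 v)  = orig (proj₁ (neighbour v)) , proj₂ (neighbour v)
neighbour {suc m} t1 = cp1 (pV m) , tt
neighbour {suc m} t2 = cp2 (pV m) , tt

data Side : Set where
  one two : Side

copy : ∀ {m} → Side → V m → V (suc m)
copy one = cp1
copy two = cp2

apex : ∀ {m} → Side → V (suc m)
apex one = t1
apex two = t2

apex-copy : ∀ {m} i (u : V m) → Adj (apex i) (copy i u)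
apex-copy one u = tt
apex-copy two u = tt

orig-copy : ∀ {m} i (u w : V m) → Adj u w → Adj (orig u) (copy i w)
orig-copy one u w h = h
orig-copy two u w h = h

copy-orig : ∀ {m} i (u w : V m) → Adj u w → Adj (copy i u) (orig w)
copy-orig one u w h = h
copy-orig two u w h = h

copy-neighbours : ∀ {m} i {x : V (suc m)} (w : V m) → Adj x (copy i w) →
  (∃[ u ] (x ≡ orig u × Adj u w)) ⊎ x ≡ apex i
copy-neighbours one {orig u} w h = inj₁ (u , refl , h)
copy-neighbours one {t1}     w h = inj₂ refl
copy-neighbours two {orig u} w h = inj₁ (u , refl , h)
copy-neighbours two {t2}     w h = inj₂ refl

allV : (m : ℕ) → List (V m)
allV zero    = map pv (allFin 4)
allV (suc m) = map orig (allV m) ++ map cp1 (allV m) ++ map cp2 (allV m) ++ t1 ∷ t2 ∷ []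

allV-complete : ∀ m (v : V m) → v ∈ allV m
allV-complete zero    (pv i)   = ∈-map⁺ pv (∈-allFin i)
allV-complete (suc m) (orig v) = ∈-++⁺ˡ (∈-map⁺ orig (allV-complete m v))
allV-complete (suc m) (cp1 v)  = ∈-++⁺ʳ (map orig (allV m)) (∈-++⁺ˡ (∈-map⁺ cp1 (allV-complete m v)))
allV-complete (suc m) (cp2 v)  =
  ∈-++⁺ʳ (map orig (allV m)) (∈-++⁺ʳ (map cp1 (allV m)) (∈-++⁺ˡ (∈-map⁺ cp2 (allV-complete m v))))
allV-complete (suc m) t1 =
  ∈-++⁺ʳ (map orig (allV m)) (∈-++⁺ʳ (map cp1 (allV m)) (∈-++⁺ʳ (map cp2 (allV m)) (here refl)))
allV-complete (suc m) t2 =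
  ∈-++⁺ʳ (map orig (allV m)) (∈-++⁺ʳ (map cp1 (allV m)) (∈-++⁺ʳ (map cp2 (allV m)) (there (here refl))))

∉-map : ∀ {a b} {A : Set a} {B : Set b} (f : A → B) {y : B} {xs : List A} →
  (∀ x → f x ≢ y) → y ∉ map f xs
∉-map f h y∈ with ∈-map⁻ f y∈
... | x , _ , e = h x (sym e)

∉-++ : ∀ {a} {A : Set a} {y : A} xs {ys} → y ∉ xs → y ∉ ys → y ∉ xs ++ ys
∉-++ xs y∉xs y∉ys y∈ with ∈-++⁻ xs y∈
... | inj₁ i = y∉xs i
... | inj₂ i = y∉ys i

map-disjoint : ∀ {a b} {A : Set a} {B : Set b} (f : A → B) {xs : List A} {ys : List B} →
  (∀ x → f x ∉ ys) → Disjoint (map f xs) ys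
map-disjoint f h (y∈ , y∈ys) with ∈-map⁻ f y∈
... | x , _ , refl = h x y∈ys

∉-apexes : ∀ {m} {v : V (suc m)} → v ≢ t1 → v ≢ t2 → v ∉ t1 ∷ t2 ∷ []
∉-apexes v≢t1 v≢t2 (here e)         = v≢t1 e
∉-apexes v≢t1 v≢t2 (there (here e)) = v≢t2 e

allV-unique : ∀ m → Unique (allV m)
allV-unique zero    = Unique.map⁺ {f = pv} (λ { refl → refl }) (Unique.allFin⁺ 4)
allV-unique (suc m) =
  Unique.++⁺ (Unique.map⁺ (λ { refl → refl }) U)
    (Unique.++⁺ (Unique.map⁺ (λ { refl → refl }) U)
      (Unique.++⁺ (Unique.map⁺ (λ { refl → refl }) U)
                  (((λ ()) ∷ []) AllPairs.∷ ([] AllPairs.∷ AllPairs.[]))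
        (map-disjoint cp2 λ _ → ∉-apexes (λ ()) (λ ())))
      (map-disjoint cp1 λ _ → ∉-++ (map cp2 A) (∉-map cp2 (λ _ ())) (∉-apexes (λ ()) (λ ()))))
    (map-disjoint orig λ _ → ∉-++ (map cp1 A) (∉-map cp1 (λ _ ()))
                               (∉-++ (map cp2 A) (∉-map cp2 (λ _ ())) (∉-apexes (λ ()) (λ ()))))
  where
  A = allV m
  U = allV-unique m

nbrs nonNbrs : ∀ {m} → V m → List (V m)
nbrs    {m} v = filter (λ u → Adj? u v) (allV m)
nonNbrs {m} v = filter (∁? (λ u → Adj? u v)) (allV m)

nbrs⁺ : ∀ {m} {u v : V m} → Adj u v → u ∈ nbrs v
nbrs⁺ {m} {u} {v} a = ∈-filter⁺ (λ u → Adj? u v) (allV-complete m u) a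

nbrs⁻ : ∀ {m} {u v : V m} → u ∈ nbrs v → Adj u v
nbrs⁻ {m} {u} {v} i = proj₂ (∈-filter⁻ (λ u → Adj? u v) {xs = allV m} i)

nonNbrs⁻ : ∀ {m} {u v : V m} → u ∈ nonNbrs v → ¬ Adj u v
nonNbrs⁻ {m} {u} {v} i = proj₂ (∈-filter⁻ (∁? (λ u → Adj? u v)) {xs = allV m} i)

nbrs-split : ∀ {m} (v : V m) → allV m ↭ nbrs v ++ nonNbrs v
nbrs-split {m} v =
  subst (λ p → allV m ↭ proj₁ p ++ proj₂ p) (partition-defn (λ u → Adj? u v) (allV m))
    (↭ₛ⇒↭ (PermutationSetoid.partition-↭ (setoid (V m)) (λ u → Adj? u v) (allV m)))

-- The smallest positive integer missing from a list ("mex"): search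
-- upwards from 1; max L + 1 candidates always suffice.
firstFree : ℕ → ℕ → List ℕ → ℕ
firstFree zero    k L = k
firstFree (suc n) k L with k ∈ℕ? L
... | yes _ = firstFree n (suc k) L
... | no _  = k

mex : List ℕ → ℕ
mex L = firstFree (max 0 L) 1 L

firstFree-≥ : ∀ n k L → k ≤ firstFree n k L
firstFree-≥ zero    k L = ≤-refl
firstFree-≥ (suc n) k L with k ∈ℕ? L
... | yes _ = ≤-trans (n≤1+n k) (firstFree-≥ n (suc k) L)
... | no _  = ≤-refl

firstFree-below : ∀ n k L j → k ≤ j → j < firstFree n k L → j ∈ L
firstFree-below zero    k L j k≤j j< = ⊥-elim (<⇒≱ j< k≤j)
firstFree-below (suc n) k L j k≤j j< with k ∈ℕ? L
... | no _ = ⊥-elim (<⇒≱ j< k≤j)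
... | yes k∈L with k Data.Nat.≟ j
...   | yes refl = k∈L
...   | no k≢j   = firstFree-below n (suc k) L j (≤∧≢⇒< k≤j k≢j) j<

firstFree-∉ : ∀ n k L → max 0 L < n + k → firstFree n k L ∉ L
firstFree-∉ zero    k L bound k∈L = <⇒≱ bound (v≤max⁺ 0 L (inj₂ (Any.map ≤-reflexive k∈L)))
firstFree-∉ (suc n) k L bound with k ∈ℕ? L
... | yes _   = firstFree-∉ n (suc k) L (≤-trans bound (≤-reflexive (sym (+-suc n k))))
... | no k∉L  = k∉L

mex-pos : ∀ L → 1 ≤ mex L
mex-pos L = firstFree-≥ (max 0 L) 1 L

mex-∉ : ∀ L → mex L ∉ L
mex-∉ L = firstFree-∉ (max 0 L) 1 L (≤-reflexive (+-comm 1 (max 0 L)))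

mex-below : ∀ L j → 1 ≤ j → j < mex L → j ∈ L
mex-below L = firstFree-below (max 0 L) 1 L

-- The least positive colour different from x: the greedy colour of a
-- vertex whose earlier neighbours all have colour x.
avoid : ℕ → ℕ
avoid (suc zero) = 2
avoid _          = 1

avoid-pos : ∀ x → 1 ≤ avoid x
avoid-pos zero          = s≤s z≤n
avoid-pos (suc zero)    = s≤s z≤n
avoid-pos (suc (suc x)) = s≤s z≤n

avoid-≢ : ∀ x → avoid x ≢ x
avoid-≢ (suc zero) ()
avoid-≢ (suc (suc x)) ()

avoid-below : ∀ x j → 1 ≤ j → j < avoid x → j ≡ x
avoid-below (suc zero) (suc zero) _ _ = refl
avoid-below zero          (suc j) _ (s≤s ())
avoid-below (suc (suc x)) (suc j) _ (s≤s ())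
avoid-below (suc zero) (suc (suc j)) _ (s≤s (s≤s ()))

module _ {m : ℕ} (c : V m → ℕ) where

  GreedyStep : List (V m) → V m → Set
  GreedyStep placed v = (∃[ u ] (u ∈ placed × Adj u v)) × SmallestFree c placed v

  GreedySteps : List (V m) → List (V m) → Set
  GreedySteps placed []       = ⊤
  GreedySteps placed (v ∷ vs) = GreedyStep placed v × GreedySteps (placed ++ v ∷ []) vs

  steps-++ : ∀ placed xs ys → GreedySteps placed xs → GreedySteps (placed ++ xs) ys →
    GreedySteps placed (xs ++ ys)
  steps-++ placed []       ys _          ys-ok =
    subst (λ p → GreedySteps p ys) (++-identityʳ placed) ys-ok
  steps-++ placed (x ∷ xs) ys (x-ok , xs-ok) ys-ok =
    x-ok , steps-++ (placed ++ x ∷ []) xs ys xs-ok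
             (subst (λ p → GreedySteps p ys) (sym (++-assoc placed (x ∷ []) xs)) ys-ok)

  steps-split : ∀ placed L pre v suf → GreedySteps placed L → L ≡ pre ++ v ∷ suf →
    GreedyStep (placed ++ pre) v
  steps-split placed (x ∷ L) []        v suf (x-ok , _) refl =
    subst (λ p → GreedyStep p v) (sym (++-identityʳ placed)) x-ok
  steps-split placed (x ∷ L) (y ∷ pre) v suf (_ , L-ok) refl =
    subst (λ p → GreedyStep p v) (++-assoc placed (y ∷ []) pre)
      (steps-split (placed ++ y ∷ []) L pre v suf L-ok refl)

  step-mono : ∀ {a b v} → GreedyStep a v → a ⊆ b → (∀ {u} → u ∈ b → Adj u v → u ∈ a) →
    GreedyStep b v
  step-mono ((u , u∈ , adj) , pos , fresh , below) a⊆b b⊆a =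
    (u , a⊆b u∈ , adj) , pos ,
    (λ { (w , w∈ , adj' , e) → fresh (w , b⊆a w∈ adj' , adj' , e) }) ,
    λ j 1≤j j< → let (w , w∈ , adj' , e) = below j 1≤j j< in w , a⊆b w∈ , adj' , e

  steps-↭ : ∀ {a b} L → a ↭ b → GreedySteps a L → GreedySteps b L
  steps-↭ []      a↭b _             = tt
  steps-↭ (v ∷ L) a↭b (v-ok , L-ok) =
    step-mono v-ok (Subset.⊆-reflexive-↭ a↭b) (λ u∈ _ → Subset.⊆-reflexive-↭ (↭-sym a↭b) u∈) ,
    steps-↭ L (++↭ a↭b ↭-refl) L-ok

  steps-independent : ∀ placed L → (∀ {v} → v ∈ L → GreedyStep placed v) →
    (∀ {v w} → v ∈ L → w ∈ L → ¬ Adj w v) → GreedySteps placed L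
  steps-independent placed []      ok indep = tt
  steps-independent placed (x ∷ L) ok indep =
    ok (here refl) ,
    steps-independent (placed ++ x ∷ []) L
      (λ v∈ → step-mono (ok (there v∈)) (Subset.xs⊆xs++ys placed (x ∷ [])) (earlier v∈))
      (λ v∈ w∈ → indep (there v∈) (there w∈))
    where
    earlier : ∀ {v u} → v ∈ L → u ∈ placed ++ x ∷ [] → Adj u v → u ∈ placed
    earlier v∈ u∈ adj with ∈-++⁻ placed u∈
    ... | inj₁ u∈placed    = u∈placed
    ... | inj₂ (here refl) = ⊥-elim (indep (there v∈) (here refl) adj)

  step-mex : ∀ placed v Ns → (∀ {u} → u ∈ Ns → u ∈ placed × Adj u v) →
    (∀ {u} → u ∈ placed → Adj u v → u ∈ Ns) → (∃[ u ] (u ∈ Ns)) →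
    c v ≡ mex (map c Ns) → GreedyStep placed v
  step-mex placed v Ns sound complete (u₀ , u₀∈) e =
    (u₀ , sound u₀∈) ,
    subst (1 ≤_) (sym e) (mex-pos (map c Ns)) ,
    (λ { (u , u∈ , adj , cu) →
         mex-∉ (map c Ns) (subst (_∈ map c Ns) (trans cu e) (∈-map⁺ c (complete u∈ adj))) }) ,
    λ j 1≤j j< → let (u , u∈ , cu) = ∈-map⁻ c (mex-below (map c Ns) j 1≤j (subst (j <_) e j<)) in
                 u , proj₁ (sound u∈) , proj₂ (sound u∈) , sym cu

  step-monochrome : ∀ placed v x → (∃[ u ] (u ∈ placed × Adj u v × c u ≡ x)) →
    (∀ {u} → u ∈ placed → Adj u v → c u ≡ x) → c v ≡ avoid x → GreedyStep placed v
  step-monochrome placed v x (u₀ , u₀∈ , adj₀ , cu₀) mono e =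
    (u₀ , u₀∈ , adj₀) ,
    subst (1 ≤_) (sym e) (avoid-pos x) ,
    (λ { (u , u∈ , adj , cu) → avoid-≢ x (trans (sym e) (trans (sym cu) (mono u∈ adj))) }) ,
    λ j 1≤j j< → u₀ , u₀∈ , adj₀ , trans cu₀ (sym (avoid-below x j 1≤j (subst (j <_) e j<)))

-- A connected greedy colouring of G_m started at s with colour α in which
-- t receives colour β; the ordering is presented as a permutation of the
-- vertex enumeration.
record Run (m : ℕ) (s t : V m) (α β : ℕ) : Set where
  field
    colour   : V m → ℕ
    rest     : List (V m)
    ordering : s ∷ rest ↭ allV m
    start    : colour s ≡ α
    steps    : GreedySteps colour (s ∷ []) rest
    end      : colour t ≡ β

run-covers : ∀ {m s t α β} (r : Run m s t α β) (v : V m) → v ∈ s ∷ Run.rest r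
run-covers {m} r v = ∈-resp-↭ (↭-sym (Run.ordering r)) (allV-complete m v)

-- A run is a connected greedy colouring: the permutation makes the ordering
-- complete and repetition-free, and every vertex is a correct step.
run⇒greedy : ∀ {m s t α β} → Run m s t α β → ∃[ c ] (ConnectedGreedy s α c × c t ≡ β)
run⇒greedy {m} {s} r = colour , (rest , unique , complete , start , step) , end
  where
  open Run r
  unique : Unique (s ∷ rest)
  unique = PermutationSetoid.Unique-resp-↭ (setoid (V m)) (↭⇒↭ₛ (↭-sym ordering)) (allV-unique m)
  complete : ∀ v → v ∈ s ∷ rest
  complete = run-covers r
  step : ∀ pre v suf → rest ≡ pre ++ v ∷ suf →
    (∃[ u ] (u ∈ s ∷ pre × Adj u v)) × SmallestFree colour (s ∷ pre) v
  step pre v suf = steps-split colour (s ∷ []) rest pre v suf steps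

-- How the colours of H are transported to the original vertices of H*:
-- f is injective, avoids the set Γ of colours carried by the new vertices
-- seen from original ones, and every colour below f a is in Γ or is f of a
-- colour below a.
record ColourEmbedding (f : ℕ → ℕ) (Γ : ℕ → Set) : Set where
  field
    injective : ∀ {a b} → f a ≡ f b → a ≡ b
    positive  : ∀ {a} → 1 ≤ a → 1 ≤ f a
    avoids    : ∀ {a} → 1 ≤ a → ¬ Γ (f a)
    below     : ∀ {a j} → 1 ≤ a → 1 ≤ j → j < f a → Γ j ⊎ ∃[ j' ] (1 ≤ j' × j' < a × f j' ≡ j)

identity-embedding : ColourEmbedding (λ a → a) (λ _ → ⊥)
identity-embedding = record
  { injective = λ e → e
  ; positive  = λ p → p
  ; avoids    = λ _ ()
  ; below     = λ {_} {j} _ 1≤j j< → inj₂ (j , 1≤j , j< , refl)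
  }

-- skip γ is the increasing bijection from ℕ onto ℕ ∖ {γ}.
skip : ℕ → ℕ → ℕ
skip zero    x       = suc x
skip (suc γ) zero    = zero
skip (suc γ) (suc x) = suc (skip γ x)

skip-injective : ∀ γ {a b} → skip γ a ≡ skip γ b → a ≡ b
skip-injective zero    e = suc-injective e
skip-injective (suc γ) {zero}  {zero}  e = refl
skip-injective (suc γ) {suc a} {suc b} e = cong suc (skip-injective γ (suc-injective e))

skip-≢ : ∀ γ a → skip γ a ≢ γ
skip-≢ zero    a       ()
skip-≢ (suc γ) (suc a) e = skip-≢ γ a (suc-injective e)

skip-≥ : ∀ γ a → a ≤ skip γ a
skip-≥ zero    a       = n≤1+n a
skip-≥ (suc γ) zero    = z≤n
skip-≥ (suc γ) (suc a) = s≤s (skip-≥ γ a)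

skip-below : ∀ γ a j → j < skip γ a → j ≡ γ ⊎ ∃[ j' ] (j' < a × skip γ j' ≡ j)
skip-below zero    a       zero    _         = inj₁ refl
skip-below zero    a       (suc j) (s≤s j<)  = inj₂ (j , j< , refl)
skip-below (suc γ) (suc a) zero    _         = inj₂ (zero , s≤s z≤n , refl)
skip-below (suc γ) (suc a) (suc j) (s≤s j<) with skip-below γ a j j<
... | inj₁ refl             = inj₁ refl
... | inj₂ (j' , j'< , e) = inj₂ (suc j' , s≤s j'< , cong suc e)

skip-embedding : ∀ γ → 1 ≤ γ → ColourEmbedding (skip γ) (_≡ γ)
skip-embedding γ@(suc _) (s≤s z≤n) = record
  { injective = skip-injective γ
  ; positive  = λ {a} 1≤a → ≤-trans 1≤a (skip-≥ γ a)
  ; avoids    = λ {a} _ → skip-≢ γ a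
  ; below     = below
  }
  where
  below : ∀ {a j} → 1 ≤ a → 1 ≤ j → j < skip γ a → j ≡ γ ⊎ ∃[ j' ] (1 ≤ j' × j' < a × skip γ j' ≡ j)
  below {a} {j} _ 1≤j j< with skip-below γ a j j<
  ... | inj₁ e                         = inj₁ e
  ... | inj₂ (suc j' , j'< , e)        = inj₂ (suc j' , s≤s z≤n , j'< , e)
  ... | inj₂ (zero , _ , refl) with 1≤j
  ...   | ()

-- Lifting a greedy sequence of H to the original vertices of H*, placed
-- after some new vertices X: an original vertex sees the originals of its
-- earlier H-neighbours, which carry the f-images of their colours, and
-- vertices of X, which carry exactly the colours of Γ.
module Lift {m : ℕ} (cH : V m → ℕ) (cS : V (suc m) → ℕ) {f : ℕ → ℕ} {Γ : ℕ → Set}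
  (embedding : ColourEmbedding f Γ)
  (lifted : ∀ u → cS (orig u) ≡ f (cH u))
  (X : List (V (suc m)))
  (X-colours : ∀ {v u} → u ∈ X → Adj u (orig v) → Γ (cS u))
  (X-complete : ∀ v {j} → Γ j → ∃[ u ] (u ∈ X × Adj u (orig v) × cS u ≡ j))
  where
  open ColourEmbedding embedding

  lift-step : ∀ placed v → GreedyStep cH placed v → GreedyStep cS (X ++ map orig placed) (orig v)
  lift-step placed v ((u , u∈ , adj) , pos , fresh , complete) =
    (orig u , ∈-++⁺ʳ X (∈-map⁺ orig u∈) , adj) ,
    subst (1 ≤_) (sym (lifted v)) (positive pos) ,
    fresh* ,
    complete*
    where
    fresh* : ¬ (∃[ w ] (w ∈ X ++ map orig placed × Adj w (orig v) × cS w ≡ cS (orig v)))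
    fresh* (w , w∈ , adj' , e) with ∈-++⁻ X w∈
    ... | inj₁ w∈X = avoids pos (subst Γ (trans e (lifted v)) (X-colours w∈X adj'))
    ... | inj₂ w∈O with ∈-map⁻ orig w∈O
    ...   | w' , w'∈ , refl =
      fresh (w' , w'∈ , adj' , injective (trans (sym (lifted w')) (trans e (lifted v))))
    complete* : ∀ j → 1 ≤ j → j < cS (orig v) →
      ∃[ w ] (w ∈ X ++ map orig placed × Adj w (orig v) × cS w ≡ j)
    complete* j 1≤j j< with below pos 1≤j (subst (j <_) (lifted v) j<)
    ... | inj₁ Γj =
      let (w , w∈ , adj' , e) = X-complete v Γj in w , ∈-++⁺ˡ w∈ , adj' , e
    ... | inj₂ (j' , 1≤j' , j'< , fj') =
      let (w , w∈ , adj' , e) = complete j' 1≤j' j'<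
      in orig w , ∈-++⁺ʳ X (∈-map⁺ orig w∈) , adj' , trans (lifted w) (trans (cong f e) fj')

  lift-steps : ∀ placed L → GreedySteps cH placed L → GreedySteps cS (X ++ map orig placed) (map orig L)
  lift-steps placed []      _             = tt
  lift-steps placed (v ∷ L) (v-ok , L-ok) =
    lift-step placed v v-ok ,
    subst (λ p → GreedySteps cS p (map orig L)) shape (lift-steps (placed ++ v ∷ []) L L-ok)
    where
    shape : X ++ map orig (placed ++ v ∷ []) ≡ (X ++ map orig placed) ++ orig v ∷ []
    shape = trans (cong (X ++_) (map-++ orig placed (v ∷ [])))
                  (sym (++-assoc X (map orig placed) (orig v ∷ [])))

copies-independent : ∀ {m} i (L : List (V m)) {v w} → v ∈ map (copy i) L → w ∈ map (copy i) L → ¬ Adj w v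
copies-independent i L v∈ w∈ with ∈-map⁻ (copy i) v∈ | ∈-map⁻ (copy i) w∈
copies-independent one L _ _ | _ , _ , refl | _ , _ , refl = λ ()
copies-independent two L _ _ | _ , _ , refl | _ , _ , refl = λ ()

copies-steps : ∀ {m} (c : V (suc m) → ℕ) i placed →
  (∀ u → orig u ∈ placed) → apex i ∉ placed →
  (∀ w → c (copy i w) ≡ mex (map (λ u → c (orig u)) (nbrs w))) →
  ∀ L → GreedySteps c placed (map (copy i) L)
copies-steps c i placed origs∈ apex∉ colours L =
  steps-independent c placed (map (copy i) L) step (copies-independent i L)
  where
  step : ∀ {v} → v ∈ map (copy i) L → GreedyStep c placed v
  step v∈ with ∈-map⁻ (copy i) v∈
  ... | w , _ , refl =
    step-mex c placed (copy i w) (map orig (nbrs w)) sound complete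
      (orig (proj₁ (neighbour w)) , ∈-map⁺ orig (nbrs⁺ (proj₂ (neighbour w))))
      (trans (colours w) (cong mex (map-∘ (nbrs w))))
    where
    sound : ∀ {u} → u ∈ map orig (nbrs w) → u ∈ placed × Adj u (copy i w)
    sound u∈ with ∈-map⁻ orig u∈
    ... | u , u∈N , refl = origs∈ u , orig-copy i u w (nbrs⁻ u∈N)
    complete : ∀ {u} → u ∈ placed → Adj u (copy i w) → u ∈ map orig (nbrs w)
    complete {u} u∈ adj with copy-neighbours i {u} w adj
    ... | inj₁ (u , refl , adj') = ∈-map⁺ orig (nbrs⁺ adj')
    ... | inj₂ refl             = ⊥-elim (apex∉ u∈)

t1-step : ∀ {m} (c : V (suc m) → ℕ) placed → (∀ u → cp1 u ∈ placed) → t2 ∉ placed →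
  c t1 ≡ mex (map c (map cp1 (allV m))) → GreedyStep c placed t1
t1-step {m} c placed cp1s∈ t2∉ =
  step-mex c placed t1 (map cp1 (allV m)) sound complete
    (cp1 (pV m) , ∈-map⁺ cp1 (allV-complete m (pV m)))
  where
  sound : ∀ {u} → u ∈ map cp1 (allV m) → u ∈ placed × Adj u t1
  sound u∈ with ∈-map⁻ cp1 u∈
  ... | u , _ , refl = cp1s∈ u , tt
  complete : ∀ {u} → u ∈ placed → Adj u t1 → u ∈ map cp1 (allV m)
  complete {cp1 u} _  _ = ∈-map⁺ cp1 (allV-complete m u)
  complete {t2}    u∈ _ = ⊥-elim (t2∉ u∈)

t2-step : ∀ {m} (c : V (suc m) → ℕ) placed → (∀ u → cp2 u ∈ placed) → t1 ∈ placed →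
  c t2 ≡ mex (map c (t1 ∷ map cp2 (allV m))) → GreedyStep c placed t2
t2-step {m} c placed cp2s∈ t1∈ =
  step-mex c placed t2 (t1 ∷ map cp2 (allV m)) sound complete (t1 , here refl)
  where
  sound : ∀ {u} → u ∈ t1 ∷ map cp2 (allV m) → u ∈ placed × Adj u t2
  sound (here refl) = t1∈ , tt
  sound (there u∈) with ∈-map⁻ cp2 u∈
  ... | u , _ , refl = cp2s∈ u , tt
  complete : ∀ {u} → u ∈ placed → Adj u t2 → u ∈ t1 ∷ map cp2 (allV m)
  complete {cp2 u} _ _ = there (∈-map⁺ cp2 (allV-complete m u))
  complete {t1}    _ _ = here refl

finish-steps : ∀ {m} (c : V (suc m) → ℕ) placed →
  (∀ u → orig u ∈ placed) → t1 ∈ placed → t2 ∉ placed →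
  (∀ w → c (cp2 w) ≡ mex (map (λ u → c (orig u)) (nbrs w))) →
  c t2 ≡ mex (map c (t1 ∷ map cp2 (allV m))) →
  GreedySteps c placed (map cp2 (allV m) ++ t2 ∷ [])
finish-steps {m} c placed origs∈ t1∈ t2∉ cp2-colours t2-colour =
  steps-++ c placed (map cp2 (allV m)) (t2 ∷ [])
    (copies-steps c two placed origs∈ t2∉ cp2-colours (allV m))
    (t2-step c (placed ++ map cp2 (allV m))
       (λ u → ∈-++⁺ʳ placed (∈-map⁺ cp2 (allV-complete m u))) (∈-++⁺ˡ t1∈) t2-colour , tt)

-- The originals come first, in the old order and with the old
-- colours; then V₁, t₁, V₂, t₂ are coloured greedily.
extend-run : ∀ {m s t α β} → Run m s t α β → Run (suc m) (orig s) (orig t) α β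
extend-run {m} {s} r = record
  { colour   = cS
  ; rest     = map orig rest ++ tail
  ; ordering = ++↭ (map⁺ orig ordering) (++⁺ˡ (map cp1 A) (↭-sym (shift t1 (map cp2 A) (t2 ∷ []))))
  ; start    = start
  ; steps    = steps-++ cS (orig s ∷ []) (map orig rest) tail originals-steps tail-steps
  ; end      = end
  }
  where
  open Run r
  A : List (V m)
  A = allV m
  tail : List (V (suc m))
  tail = map cp1 A ++ t1 ∷ map cp2 A ++ t2 ∷ []
  copyColour : V m → ℕ
  copyColour w = mex (map colour (nbrs w))
  cS : V (suc m) → ℕ
  cS (orig u) = colour u
  cS (cp1 w)  = copyColour w
  cS (cp2 w)  = copyColour w
  cS t1       = mex (map copyColour A)
  cS t2       = mex (mex (map copyColour A) ∷ map copyColour A)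
  originals : List (V (suc m))
  originals = map orig (s ∷ rest)
  originals-steps : GreedySteps cS (orig s ∷ []) (map orig rest)
  originals-steps =
    Lift.lift-steps colour cS identity-embedding (λ _ → refl) [] (λ ()) (λ _ ()) (s ∷ []) rest steps
  origs∈ : ∀ u → orig u ∈ originals
  origs∈ u = ∈-map⁺ orig (run-covers r u)
  t2∉ : t2 ∉ originals ++ map cp1 A
  t2∉ = ∉-++ originals (∉-map orig λ _ ()) (∉-map cp1 λ _ ())
  tail-steps : GreedySteps cS originals tail
  tail-steps =
    steps-++ cS originals (map cp1 A) (t1 ∷ map cp2 A ++ t2 ∷ [])
      (copies-steps cS one originals origs∈ (∉-map orig λ _ ()) (λ _ → refl) A)
      ( t1-step cS (originals ++ map cp1 A) (λ u → ∈-++⁺ʳ originals (∈-map⁺ cp1 (allV-complete m u))) t2∉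
          (cong mex (map-∘ A))
      , finish-steps cS ((originals ++ map cp1 A) ++ t1 ∷ [])
          (λ u → ∈-++⁺ˡ (∈-++⁺ˡ (origs∈ u))) (∈-++⁺ʳ (originals ++ map cp1 A) (here refl))
          (∉-++ (originals ++ map cp1 A) t2∉ λ { (here ()) ; (there ()) }) (λ _ → refl)
          (cong (λ L → mex (mex (map copyColour A) ∷ L)) (map-∘ A)))

-- Construction B: a run on G_m yields a run on G_{m+1} in which every old
-- colour a becomes skip γ a, where the new colour γ ∈ {1, 2} is given to
-- all of V₁ and δ = avoid γ to t₁.  Order: s, the copies of the
-- neighbours of s (which see only s), t₁, the other copies in V₁ (which
-- see only t₁), the remaining originals (which see V₁, i.e. the colour γ,
-- besides their old neighbours), then V₂ and t₂ greedily.  The hypotheses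
-- say that γ is the greedy colour next to skip γ α, and that γ, δ are the
-- greedy colours next to each other.
module Shift {m : ℕ} {s t : V m} {α β : ℕ} (γ : ℕ)
  (γ-δ : avoid (avoid γ) ≡ γ) (γ-α : avoid (skip γ α) ≡ γ) (r : Run m s t α β) where
  open Run r
  open CMSolver (++-commutativeMonoid {A = V (suc m)})

  A N N̄ : List (V m)
  A = allV m
  N = nbrs s
  N̄ = nonNbrs s

  δ : ℕ
  δ = avoid γ

  cp2Colour : V m → ℕ
  cp2Colour w = mex (map (λ u → skip γ (colour u)) (nbrs w))

  cS : V (suc m) → ℕ
  cS (orig u) = skip γ (colour u)
  cS (cp1 _)  = γ
  cS (cp2 w)  = cp2Colour w
  cS t1       = δ
  cS t2       = mex (δ ∷ map cp2Colour A)

  X : List (V (suc m))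
  X = map cp1 N ++ t1 ∷ map cp1 N̄

  P₁ P₂ P₃ P₄ : List (V (suc m))
  P₁ = orig s ∷ map cp1 N
  P₂ = P₁ ++ t1 ∷ []
  P₃ = P₂ ++ map cp1 N̄
  P₄ = P₃ ++ map orig rest

  -- The copies of the neighbours of s see only s, coloured skip γ α.
  copies-of-nbrs : GreedySteps cS (orig s ∷ []) (map cp1 N)
  copies-of-nbrs = steps-independent cS _ (map cp1 N) step (copies-independent one N)
    where
    step : ∀ {v} → v ∈ map cp1 N → GreedyStep cS (orig s ∷ []) v
    step v∈ with ∈-map⁻ cp1 v∈
    ... | w , w∈ , refl =
      step-monochrome cS _ (cp1 w) (skip γ α)
        (orig s , here refl , Adj-sym w s (nbrs⁻ w∈) , cong (skip γ) start)
        (λ { (here refl) _ → cong (skip γ) start ; (there ()) _ })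
        (sym γ-α)

  -- t₁ sees only copies of neighbours of s, all coloured γ.
  apex-step : GreedyStep cS P₁ t1
  apex-step = step-monochrome cS P₁ t1 γ
    (cp1 w₀ , there (∈-map⁺ cp1 (nbrs⁺ a₀)) , tt , refl) mono refl
    where
    w₀ = proj₁ (neighbour s)
    a₀ = proj₂ (neighbour s)
    mono : ∀ {u} → u ∈ P₁ → Adj u t1 → cS u ≡ γ
    mono (here refl) ()
    mono (there u∈) _ with ∈-map⁻ cp1 u∈
    ... | _ , _ , refl = refl

  -- The remaining copies in V₁ see only t₁, coloured δ.
  copies-of-others : GreedySteps cS P₂ (map cp1 N̄)
  copies-of-others = steps-independent cS P₂ (map cp1 N̄) step (copies-independent one N̄)
    where
    step : ∀ {v} → v ∈ map cp1 N̄ → GreedyStep cS P₂ v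
    step v∈ with ∈-map⁻ cp1 v∈
    ... | w , w∈ , refl =
      step-monochrome cS P₂ (cp1 w) δ (t1 , ∈-++⁺ʳ P₁ (here refl) , tt , refl) mono (sym γ-δ)
      where
      mono : ∀ {u} → u ∈ P₂ → Adj u (cp1 w) → cS u ≡ δ
      mono u∈ adj with ∈-++⁻ P₁ u∈
      ... | inj₁ (here refl)  = ⊥-elim (nonNbrs⁻ w∈ (Adj-sym s w adj))
      ... | inj₁ (there u∈N)  with ∈-map⁻ cp1 u∈N
      ...   | _ , _ , refl    = ⊥-elim adj
      mono u∈ adj | inj₂ (here refl) = refl

  cp1∈X : ∀ w → cp1 w ∈ X
  cp1∈X w with ∈-++⁻ N (∈-resp-↭ (nbrs-split s) (allV-complete m w))
  ... | inj₁ w∈N = ∈-++⁺ˡ (∈-map⁺ cp1 w∈N)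
  ... | inj₂ w∈N̄ = ∈-++⁺ʳ (map cp1 N) (there (∈-map⁺ cp1 w∈N̄))

  X-colours : ∀ {v u} → u ∈ X → Adj u (orig v) → cS u ≡ γ
  X-colours u∈ adj with ∈-++⁻ (map cp1 N) u∈
  ... | inj₁ u∈N with ∈-map⁻ cp1 u∈N
  ...   | _ , _ , refl = refl
  X-colours u∈ () | inj₂ (here refl)
  X-colours u∈ adj | inj₂ (there u∈N̄) with ∈-map⁻ cp1 u∈N̄
  ...   | _ , _ , refl = refl

  -- The originals are lifted past X, up to the order of the placed vertices.
  originals-steps : GreedySteps cS P₃ (map orig rest)
  originals-steps =
    steps-↭ cS (map orig rest) (solve 4 (λ a b c d → (b ⊕ (c ⊕ d)) ⊕ a ⊜ ((a ⊕ b) ⊕ c) ⊕ d) ↭-refl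
                              (orig s ∷ []) (map cp1 N) (t1 ∷ []) (map cp1 N̄))
      (Lift.lift-steps colour cS (skip-embedding γ γ≥1) (λ _ → refl) X X-colours
         (λ v {j} j≡γ → cp1 (proj₁ (neighbour v)) , cp1∈X _ , proj₂ (neighbour v) , sym j≡γ)
         (s ∷ []) rest steps)
    where
    γ≥1 : 1 ≤ γ
    γ≥1 = subst (1 ≤_) γ-δ (avoid-pos δ)

  origs∈P₄ : ∀ u → orig u ∈ P₄
  origs∈P₄ u with run-covers r u
  ... | here refl = here refl
  ... | there u∈  = ∈-++⁺ʳ P₃ (∈-map⁺ orig u∈)

  t2∉P₄ : t2 ∉ P₄
  t2∉P₄ =
    ∉-++ P₃ (∉-++ P₂ (∉-++ P₁ (λ { (here ()) ; (there u∈) → ∉-map cp1 (λ _ ()) u∈ })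
                              (λ { (here ()) ; (there ()) }))
                     (∉-map cp1 λ _ ()))
            (∉-map orig λ _ ())

  order : orig s ∷ map cp1 N ++ t1 ∷ map cp1 N̄ ++ map orig rest ++ map cp2 A ++ t2 ∷ [] ↭ allV (suc m)
  order = ↭-trans
    (solve 7 (λ a b c d e f g → a ⊕ (b ⊕ (c ⊕ (d ⊕ (e ⊕ (f ⊕ g)))))
                              ⊜ (a ⊕ e) ⊕ ((b ⊕ d) ⊕ (f ⊕ (c ⊕ g)))) ↭-refl
       (orig s ∷ []) (map cp1 N) (t1 ∷ []) (map cp1 N̄) (map orig rest) (map cp2 A) (t2 ∷ []))
    (++↭ (map⁺ orig ordering) (++↭ copies ↭-refl))
    where
    copies : map cp1 N ++ map cp1 N̄ ↭ map cp1 A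
    copies = subst (_↭ map cp1 A) (map-++ cp1 N N̄) (map⁺ cp1 (↭-sym (nbrs-split s)))

  run : Run (suc m) (orig s) (orig t) (skip γ α) (skip γ β)
  run = record
    { colour   = cS
    ; rest     = map cp1 N ++ t1 ∷ map cp1 N̄ ++ map orig rest ++ map cp2 A ++ t2 ∷ []
    ; ordering = order
    ; start    = cong (skip γ) start
    ; steps    =
        steps-++ cS (orig s ∷ []) (map cp1 N) _ copies-of-nbrs
          (apex-step ,
           steps-++ cS P₂ (map cp1 N̄) _ copies-of-others
             (steps-++ cS P₃ (map orig rest) _ originals-steps
                (finish-steps cS P₄ origs∈P₄ (∈-++⁺ˡ (∈-++⁺ˡ (∈-++⁺ʳ P₁ (here refl)))) t2∉P₄ (λ _ → refl)
                   (cong (λ L → mex (δ ∷ L)) (map-∘ A)))))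
    ; end      = cong (skip γ) end
    }

shift-run : ∀ {m s t α β} γ → avoid (avoid γ) ≡ γ → avoid (skip γ α) ≡ γ →
  Run m s t α β → Run (suc m) (orig s) (orig t) (skip γ α) (skip γ β)
shift-run γ γ-δ γ-α r = Shift.run γ γ-δ γ-α r

-- The base case: the greedy colouring of the path p, x, y, q along the
-- path, started with an arbitrary colour a; each vertex sees only its
-- predecessor.
path-run : ∀ a → Run 0 (pV 0) (qV 0) a (avoid (avoid (avoid a)))
path-run a = record
  { colour   = c
  ; rest     = x ∷ y ∷ q ∷ []
  ; ordering = ↭-refl
  ; start    = refl
  ; steps    = x-step , y-step , q-step , tt
  ; end      = refl
  }
  where
  p x y q : V 0
  p = pv fz
  x = pv (fs fz)
  y = pv (fs (fs fz))
  q = pv (fs (fs (fs fz)))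
  c : V 0 → ℕ
  c (pv fz)                = a
  c (pv (fs fz))           = avoid a
  c (pv (fs (fs fz)))      = avoid (avoid a)
  c (pv (fs (fs (fs fz)))) = avoid (avoid (avoid a))
  x-step : GreedyStep c (p ∷ []) x
  x-step = step-monochrome c _ x a (p , here refl , inj₁ refl , refl)
    (λ { (here refl) _ → refl ; (there ()) _ }) refl
  y-step : GreedyStep c (p ∷ x ∷ []) y
  y-step = step-monochrome c _ y (avoid a) (x , there (here refl) , inj₁ refl , refl)
    (λ { (here refl) (inj₁ ()) ; (here refl) (inj₂ ()) ; (there (here refl)) _ → refl
       ; (there (there ())) _ }) refl
  q-step : GreedyStep c (p ∷ x ∷ y ∷ []) q
  q-step = step-monochrome c _ q (avoid (avoid a)) (y , there (there (here refl)) , inj₁ refl , refl)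
    (λ { (here refl) (inj₁ ()) ; (here refl) (inj₂ ())
       ; (there (here refl)) (inj₁ ()) ; (there (here refl)) (inj₂ ())
       ; (there (there (here refl))) _ → refl ; (there (there (there ()))) _ }) refl

shift-past-1 : ∀ {m s t a b} → Run m s t (suc a) (suc b) → Run (suc m) (orig s) (orig t) (2 + a) (2 + b)
shift-past-1 = shift-run 1 refl refl

shift-past-2 : ∀ {m s t b} → Run m s t 1 (2 + b) → Run (suc m) (orig s) (orig t) 1 (3 + b)
shift-past-2 = shift-run 2 refl refl

-- The invariant proved by induction on m: runs from p to q on G_m realise
-- all distinct positive end colours α, β with β ≤ m + 2, provided that
-- α ≤ m + 2 or β ≤ m + 1.  (The theorem only needs α, β ≤ m + 2.)
Realised : ℕ → Set
Realised m = ∀ α β → 1 ≤ α → 1 ≤ β → β ≤ 2 + m → α ≢ β → α ≤ 2 + m ⊎ β ≤ 1 + m →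
  Run m (pV m) (qV m) α β

-- β = 2 + m on G_{m+1}: extend, or (if α is large) shift a run ending in 1 + m.
old-top : ∀ m α → 1 ≤ α → α ≢ 2 + m → Realised m → Run (suc m) (pV (suc m)) (qV (suc m)) α (2 + m)
old-top m α 1≤α α≢ realised with α ≤? 2 + m
... | yes α≤ = extend-run (realised α (2 + m) 1≤α (s≤s z≤n) ≤-refl α≢ (inj₁ α≤))
old-top m (suc zero)    _ _ _ | no α≰ = ⊥-elim (α≰ (s≤s z≤n))
old-top m (suc (suc a)) _ _ realised | no α≰ =
  shift-past-1 (realised (suc a) (suc m) (s≤s z≤n) (s≤s z≤n) (n≤1+n _) a≢m (inj₂ ≤-refl))
  where
  a≢m : suc a ≢ suc m
  a≢m refl = α≰ ≤-refl

-- β = 3 + m on G_{m+1}: shift a run ending in 2 + m.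
new-top : ∀ m α → 1 ≤ α → α ≤ 2 + m → Realised m → Run (suc m) (pV (suc m)) (qV (suc m)) α (3 + m)
new-top m (suc zero)    _ _ realised =
  shift-past-2 (realised 1 (2 + m) (s≤s z≤n) (s≤s z≤n) ≤-refl (λ ()) (inj₁ (s≤s z≤n)))
new-top m (suc (suc a)) _ (s≤s α≤) realised =
  shift-past-1 (realised (suc a) (2 + m) (s≤s z≤n) (s≤s z≤n) ≤-refl
                  (λ e → <⇒≢ α≤ (suc-injective e)) (inj₁ (≤-trans α≤ (n≤1+n _))))

-- On the path the greedy runs give (1, 2) and (a + 2, 1); on G_{m+1}, end
-- colours β ≤ m + 1 come from extending runs on G_m.
realised : ∀ m → Realised m
realised zero (suc zero)          (suc zero)       _ _ _ α≢β _ = ⊥-elim (α≢β refl)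
realised zero (suc zero)          (suc (suc zero)) _ _ _ _   _ = path-run 1
realised zero (suc (suc a))       (suc zero)       _ _ _ _   _ = path-run (2 + a)
realised zero (suc (suc zero))    (suc (suc zero)) _ _ _ α≢β _ = ⊥-elim (α≢β refl)
realised zero (suc (suc (suc _))) (suc (suc zero)) _ _ _ _ (inj₁ (s≤s (s≤s ())))
realised zero (suc (suc (suc _))) (suc (suc zero)) _ _ _ _ (inj₂ (s≤s ()))
realised zero _ (suc (suc (suc _))) _ _ (s≤s (s≤s ())) _ _
realised (suc m) α β 1≤α 1≤β β≤ α≢β bound with <-cmp β (2 + m)
... | tri< β< _ _ = extend-run (realised m α β 1≤α 1≤β (<⇒≤ β<) α≢β (inj₂ (s≤s⁻¹ β<)))
... | tri≈ _ refl _ = old-top m α 1≤α α≢β (realised m)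
... | tri> _ _ β> with ≤-antisym β≤ β>
...   | refl = new-top m α 1≤α α≤ (realised m)
  where
  α≤ : α ≤ 2 + m
  α≤ = [ (λ α≤3+m → s≤s⁻¹ (≤∧≢⇒< α≤3+m α≢β)) , (λ β≤2+m → ⊥-elim (<⇒≱ β> β≤2+m)) ] bound

-- Reflecting the path p, x, y, q extends to an automorphism of every G_m
-- (applied in every copy) which exchanges p and q.
reflect : ∀ {m} → V m → V m
reflect (pv i)   = pv (opposite i)
reflect (orig v) = orig (reflect v)
reflect (cp1 v)  = cp1 (reflect v)
reflect (cp2 v)  = cp2 (reflect v)
reflect t1       = t1
reflect t2       = t2

reflect-involutive : ∀ {m} (v : V m) → reflect (reflect v) ≡ v
reflect-involutive (pv i)   = cong pv (opposite-involutive i)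
reflect-involutive (orig v) = cong orig (reflect-involutive v)
reflect-involutive (cp1 v)  = cong cp1 (reflect-involutive v)
reflect-involutive (cp2 v)  = cong cp2 (reflect-involutive v)
reflect-involutive t1       = refl
reflect-involutive t2       = refl

reflect-p : ∀ m → reflect (pV m) ≡ qV m
reflect-p zero    = refl
reflect-p (suc m) = cong orig (reflect-p m)

-- On the path, the positions of i and of its mirror image add up to 3, so
-- consecutive positions stay consecutive.
opposite-sum : ∀ (i : Fin 4) → toℕ (opposite i) + toℕ i ≡ 3
opposite-sum fz                = refl
opposite-sum (fs fz)           = refl
opposite-sum (fs (fs fz))      = refl
opposite-sum (fs (fs (fs fz))) = refl

opposite-step : ∀ (i j : Fin 4) → suc (toℕ i) ≡ toℕ j → suc (toℕ (opposite j)) ≡ toℕ (opposite i)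
opposite-step i j e = +-cancelʳ-≡ (toℕ i) _ _ (begin
  suc (toℕ (opposite j)) + toℕ i   ≡⟨ sym (+-suc (toℕ (opposite j)) (toℕ i)) ⟩
  toℕ (opposite j) + suc (toℕ i)   ≡⟨ cong (toℕ (opposite j) +_) e ⟩
  toℕ (opposite j) + toℕ j         ≡⟨ opposite-sum j ⟩
  3                                ≡⟨ sym (opposite-sum i) ⟩
  toℕ (opposite i) + toℕ i         ∎)
  where open ≡-Reasoning

reflect-adj : ∀ {m} (u v : V m) → Adj u v → Adj (reflect u) (reflect v)
reflect-adj (pv i)   (pv j)   (inj₁ e) = inj₂ (opposite-step i j e)
reflect-adj (pv i)   (pv j)   (inj₂ e) = inj₁ (opposite-step j i e)
reflect-adj (orig a) (orig b) h = reflect-adj a b h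
reflect-adj (orig a) (cp1 b)  h = reflect-adj a b h
reflect-adj (cp1 a)  (orig b) h = reflect-adj a b h
reflect-adj (orig a) (cp2 b)  h = reflect-adj a b h
reflect-adj (cp2 a)  (orig b) h = reflect-adj a b h
reflect-adj t1       (cp1 _)  h = tt
reflect-adj (cp1 _)  t1       h = tt
reflect-adj t2       (cp2 _)  h = tt
reflect-adj (cp2 _)  t2       h = tt
reflect-adj t1       t2       h = tt
reflect-adj t2       t1       h = tt

-- Connected greedy colourings are transported by any involutive
-- automorphism σ: the ordering is mapped by σ and the colouring becomes c ∘ σ.
module Automorphism {m : ℕ} (σ : V m → V m) (σσ : ∀ v → σ (σ v) ≡ v)
  (σ-adj : ∀ u v → Adj u v → Adj (σ u) (σ v)) where

  map-σσ : ∀ L → map σ (map σ L) ≡ L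
  map-σσ L = trans (sym (map-∘ L)) (trans (map-cong σσ L) (map-id L))

  ∈-σ : ∀ {u L} → σ u ∈ L → u ∈ map σ L
  ∈-σ {u} {L} h = subst (_∈ map σ L) (σσ u) (∈-map⁺ σ h)

  σ-∈ : ∀ {u L} → u ∈ map σ L → σ u ∈ L
  σ-∈ h with ∈-map⁻ σ h
  ... | x , x∈ , refl = subst (_∈ _) (sym (σσ x)) x∈

  σ-adj⁺ : ∀ {u v} → Adj u (σ v) → Adj (σ u) v
  σ-adj⁺ {u} {v} a = subst (Adj (σ u)) (σσ v) (σ-adj u (σ v) a)

  smallestFree-σ : ∀ c L v → SmallestFree c L (σ v) → SmallestFree (λ w → c (σ w)) (map σ L) v
  smallestFree-σ c L v (pos , fresh , complete) =
    pos ,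
    (λ { (w , w∈ , adj , e) → fresh (σ w , σ-∈ w∈ , σ-adj w v adj , e) }) ,
    λ j 1≤j j< → let (u , u∈ , adj , e) = complete j 1≤j j< in
      σ u , ∈-map⁺ σ u∈ , σ-adj⁺ adj , trans (cong c (σσ u)) e

  greedy-σ : ∀ {s α c} → ConnectedGreedy s α c → ConnectedGreedy (σ s) α (λ v → c (σ v))
  greedy-σ {s} {α} {c} (rest , unique , complete , start , steps) =
    map σ rest ,
    Unique.map⁺ σ-injective unique ,
    (λ v → ∈-σ (complete (σ v))) ,
    trans (cong c (σσ s)) start ,
    step
    where
    σ-injective : ∀ {u v} → σ u ≡ σ v → u ≡ v
    σ-injective {u} {v} e = trans (sym (σσ u)) (trans (cong σ e) (σσ v))
    step : ∀ pre v suf → map σ rest ≡ pre ++ v ∷ suf →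
      (∃[ u ] (u ∈ σ s ∷ pre × Adj u v)) × SmallestFree (λ w → c (σ w)) (σ s ∷ pre) v
    step pre v suf e with steps (map σ pre) (σ v) (map σ suf) pulled
      where
      pulled : rest ≡ map σ pre ++ σ v ∷ map σ suf
      pulled = trans (sym (map-σσ rest)) (trans (cong (map σ) e) (map-++ σ pre (v ∷ suf)))
    ... | (u , u∈ , adj) , free =
      (σ u , subst (σ u ∈_) image (∈-map⁺ σ u∈) , σ-adj⁺ adj) ,
      subst (λ L → SmallestFree (λ w → c (σ w)) L v) image (smallestFree-σ c (s ∷ map σ pre) v free)
      where
      image : map σ (s ∷ map σ pre) ≡ σ s ∷ pre
      image = cong (σ s ∷_) (map-σσ pre)

-- The path is
-- 2-coloured by parity; on G_{m+1} the originals and V₁ keep their colours,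
-- V₂ too except that colour 0 becomes the new colour m + 2, t₁ gets the
-- new colour and t₂ the colour 0.
parity : ℕ → Fin 2
parity zero          = fz
parity (suc zero)    = fs fz
parity (suc (suc n)) = parity n

parity-suc : ∀ n → parity n ≢ parity (suc n)
parity-suc zero          ()
parity-suc (suc zero)    ()
parity-suc (suc (suc n)) = parity-suc n

raise : ∀ {n} → Fin (suc n) → Fin (suc (suc n))
raise fz     = fromℕ _
raise (fs i) = inject₁ (fs i)

raise-≢ : ∀ {n} (i j : Fin (suc n)) → i ≢ j → inject₁ i ≢ raise j
raise-≢ i fz     _   e = fromℕ≢inject₁ (sym e)
raise-≢ i (fs j) i≢j e = i≢j (inject₁-injective e)

raise-≢0 : ∀ {n} (i : Fin (suc n)) → fz ≢ raise i
raise-≢0 fz     ()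
raise-≢0 (fs i) ()

colouring : ∀ m → V m → Fin (2 + m)
colouring zero    (pv i)   = parity (toℕ i)
colouring (suc m) (orig u) = inject₁ (colouring m u)
colouring (suc m) (cp1 u)  = inject₁ (colouring m u)
colouring (suc m) (cp2 u)  = raise (colouring m u)
colouring (suc m) t1       = fromℕ (2 + m)
colouring (suc m) t2       = fz

colouring-proper : ∀ m → Proper (colouring m)
colouring-proper zero    (pv i)   (pv j)   (inj₁ e) =
  subst (λ k → parity (toℕ i) ≢ parity k) e (parity-suc (toℕ i))
colouring-proper zero    (pv i)   (pv j)   (inj₂ e) =
  subst (λ k → parity k ≢ parity (toℕ j)) e (parity-suc (toℕ j) ∘ sym)
colouring-proper (suc m) (orig a) (orig b) h = colouring-proper m a b h ∘ inject₁-injective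
colouring-proper (suc m) (orig a) (cp1 b)  h = colouring-proper m a b h ∘ inject₁-injective
colouring-proper (suc m) (cp1 a)  (orig b) h = colouring-proper m a b h ∘ inject₁-injective
colouring-proper (suc m) (orig a) (cp2 b)  h = raise-≢ _ _ (colouring-proper m a b h)
colouring-proper (suc m) (cp2 a)  (orig b) h = raise-≢ _ _ (colouring-proper m b a (Adj-sym a b h)) ∘ sym
colouring-proper (suc m) t1       (cp1 b)  h = fromℕ≢inject₁
colouring-proper (suc m) (cp1 a)  t1       h = fromℕ≢inject₁ ∘ sym
colouring-proper (suc m) t2       (cp2 b)  h = raise-≢0 (colouring m b)
colouring-proper (suc m) (cp2 a)  t2       h = raise-≢0 (colouring m a) ∘ sym
colouring-proper (suc m) t1       t2       h = λ ()
colouring-proper (suc m) t2       t1       h = λ ()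

-- The Mycielski reduction: from a proper colouring c of G_{m+1} with n + 1
-- colours and a side i, recolour each original u having the colour of the
-- apex tᵢ with the colour of its copy uᵢ; the colour of tᵢ is then unused
-- on the originals and can be squeezed out, leaving n colours on G_m.
module Reduce {m n : ℕ} (i : Side) (c : V (suc m) → Fin (suc n)) (proper : Proper c) where

  a : Fin (suc n)
  a = c (apex i)

  recolour : V m → Fin (suc n)
  recolour u with c (orig u) ≟ᶠ a
  ... | yes _ = c (copy i u)
  ... | no _  = c (orig u)

  recolour-avoids : ∀ u → a ≢ recolour u
  recolour-avoids u with c (orig u) ≟ᶠ a
  ... | yes _ = proper (apex i) (copy i u) (apex-copy i u)
  ... | no ne = ne ∘ sym

  recolour-proper : Proper recolour
  recolour-proper u w adj with c (orig u) ≟ᶠ a | c (orig w) ≟ᶠ a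
  ... | yes eu | yes ew = λ _ → proper (orig u) (orig w) adj (trans eu (sym ew))
  ... | yes _  | no _   = proper (copy i u) (orig w) (copy-orig i u w adj)
  ... | no _   | yes _  = proper (orig u) (copy i w) (orig-copy i u w adj)
  ... | no _   | no _   = proper (orig u) (orig w) adj

  recolour-keeps : ∀ u → c (orig u) ≢ a → recolour u ≡ c (orig u)
  recolour-keeps u ne with c (orig u) ≟ᶠ a
  ... | yes e = ⊥-elim (ne e)
  ... | no _  = refl

  reduced : V m → Fin n
  reduced u = punchOut (recolour-avoids u)

  reduced-proper : Proper reduced
  reduced-proper u w adj e =
    recolour-proper u w adj (punchOut-injective (recolour-avoids u) (recolour-avoids w) e)

  reduced-keeps : ∀ u w → c (orig u) ≡ c (orig w) → c (orig u) ≢ a → reduced u ≡ reduced w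
  reduced-keeps u w e ne =
    punchOut-cong a (trans (recolour-keeps u ne)
                      (trans e (sym (recolour-keeps w (λ e' → ne (trans e e'))))))

colours-needed : ∀ m n → Colorable m n → 2 + m ≤ n
colours-needed zero    zero    (c , _) with c (pv fz)
... | ()
colours-needed zero    (suc zero) (c , proper) with c (pv fz) in e₀ | c (pv (fs fz)) in e₁
... | fz | fz = ⊥-elim (proper (pv fz) (pv (fs fz)) (inj₁ refl) (trans e₀ (sym e₁)))
colours-needed zero    (suc (suc n)) _ = s≤s (s≤s z≤n)
colours-needed (suc m) zero    (c , _) with c t1
... | ()
colours-needed (suc m) (suc n) (c , proper) =
  s≤s (colours-needed m n (reduced , reduced-proper))
  where open Reduce one c proper

three-in-two : (a b c : Fin 2) → a ≢ b → b ≢ c → c ≢ a → ⊥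
three-in-two fz      fz      _       a≢b _   _   = a≢b refl
three-in-two (fs fz) (fs fz) _       a≢b _   _   = a≢b refl
three-in-two fz      (fs fz) fz      _   _   c≢a = c≢a refl
three-in-two fz      (fs fz) (fs fz) _   b≢c _   = b≢c refl
three-in-two (fs fz) fz      fz      _   b≢c _   = b≢c refl
three-in-two (fs fz) fz      (fs fz) _   _   c≢a = c≢a refl

-- If p and q have the same colour, G_m needs at least m + 3 colours:
-- on the path, p, x, y get three distinct colours; on G_{m+1} reduce on a
-- side whose apex is not coloured like p.
colours-needed-pq : ∀ m n (c : V m → Fin n) → Proper c → c (pV m) ≡ c (qV m) → 3 + m ≤ n
colours-needed-pq zero zero c proper _ with colours-needed zero zero (c , proper)
... | ()
colours-needed-pq zero (suc zero) c proper _ with colours-needed zero 1 (c , proper)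
... | s≤s ()
colours-needed-pq zero (suc (suc zero)) c proper p≡q =
  ⊥-elim (three-in-two (c (pv fz)) (c (pv (fs fz))) (c (pv (fs (fs fz))))
    (proper _ _ (inj₁ refl)) (proper _ _ (inj₁ refl))
    (λ y≡p → proper (pv (fs (fs fz))) (pv (fs (fs (fs fz)))) (inj₁ refl) (trans y≡p p≡q)))
colours-needed-pq zero (suc (suc (suc n))) _ _ _ = s≤s (s≤s (s≤s z≤n))
colours-needed-pq (suc m) zero c _ _ with c t1
... | ()
colours-needed-pq (suc m) (suc n) c proper p≡q with c (orig (pV m)) ≟ᶠ c t1
... | yes p≡t1 =
  s≤s (colours-needed-pq m n reduced reduced-proper (reduced-keeps (pV m) (qV m) p≡q p≢t2))
  where
  open Reduce two c proper
  p≢t2 : c (orig (pV m)) ≢ c t2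
  p≢t2 p≡t2 = proper t1 t2 tt (trans (sym p≡t1) p≡t2)
... | no p≢t1 = s≤s (colours-needed-pq m n reduced reduced-proper (reduced-keeps (pV m) (qV m) p≡q p≢t1))
  where open Reduce one c proper

swap-ends : ∀ m {α β} → ∃[ c ] (ConnectedGreedy (pV m) β c × c (qV m) ≡ α) →
  ∃[ c ] (ConnectedGreedy (qV m) β c × c (pV m) ≡ α)
swap-ends m (c , greedy , q↦α) =
  (λ v → c (reflect v)) ,
  subst (λ s → ConnectedGreedy s _ (λ v → c (reflect v))) (reflect-p m) (greedy-σ greedy) ,
  trans (cong c (reflect-p m)) q↦α
  where open Automorphism reflect reflect-involutive reflect-adj

lemma7 : (k : ℕ) → 3 ≤ k →
    (ChromaticNumber (Data.Nat._∸_ k 1) (suc k)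
    × (∀ (c : Gk k → Fin (suc k)) → Proper c → ¬ (c (pG k) ≡ c (qG k))))
    × (∀ (α β : ℕ) → 1 ≤ α → α ≤ suc k → 1 ≤ β → β ≤ suc k → ¬ (α ≡ β) →
    (∃[ c ] (ConnectedGreedy (pG k) α c × c (qG k) ≡ β))
    × (∃[ c ] (ConnectedGreedy (qG k) β c × c (pG k) ≡ α)))
lemma7 (suc m@(suc (suc _))) (s≤s (s≤s (s≤s _))) = (chromatic , p≢q) , greedy
  where
  chromatic : ChromaticNumber m (suc (suc m))
  chromatic = (colouring m , colouring-proper m) , colours-needed m
  p≢q : ∀ (c : V m → Fin (suc (suc m))) → Proper c → c (pV m) ≢ c (qV m)
  p≢q c proper p≡q = 1+n≰n (colours-needed-pq m (suc (suc m)) c proper p≡q)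
  greedy : ∀ α β → 1 ≤ α → α ≤ 2 + m → 1 ≤ β → β ≤ 2 + m → α ≢ β →
    (∃[ c ] (ConnectedGreedy (pV m) α c × c (qV m) ≡ β)) ×
    (∃[ c ] (ConnectedGreedy (qV m) β c × c (pV m) ≡ α))
  greedy α β 1≤α α≤ 1≤β β≤ α≢β =
    run⇒greedy (realised m α β 1≤α 1≤β β≤ α≢β (inj₁ α≤)) ,
    swap-ends m (run⇒greedy (realised m β α 1≤β 1≤α α≤ (α≢β ∘ sym) (inj₁ β≤)))
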